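{- Let $L$ be a pretransitive normal modal logic. Then (1) $L[1]\supseteq L[2]\supseteq L[3]\supseteq\dots\supseteq L$; (2) if $L$ is consistent, then $L[1]$ is consistent (and hence every $L[h]$, $h\geq1$, is consistent).
   Context: Modal formulas: variables, $\bot,\top$, Boolean connectives, unary $\Diamond$; $\Box\varphi=\neg\Diamond\neg\varphi$; $\Diamond^i,\Box^i$ iterations; $\Diamond^{\le m}\varphi=\bigvee_{i=0}^m\Diamond^i\varphi$, $\Box^{\le m}\varphi=\bigwedge_{i=0}^m\Box^i\varphi$. A (normal) logic is a set of formulas containing all tautologies, $\neg\Diamond\bot$, $\Diamond(p_1\vee p_2)\to\Diamond p_1\vee\Diamond p_2$, closed under modus ponens, substitution, and monotonicity (from $\varphi\to\psi$ infer $\Diamond\varphi\to\Diamond\psi$); $L+\Phi$ is the least logic containing $L\cup\Phi$; $L$ is consistent if $\bot\notin L$. $L$ is pretransitive if it contains $\Diamond^{m+1}p\to\Diamond^{\le m}p$ for some $m\ge0$; $\mathrm{tr}(L)$ is the least such $m$. $B_1(m)=p_1\to\Box^{\le m}\Diamond^{\le m}p_1$, $B_{h+1}(m)=p_{h+1}\to\Box^{\le m}(\Diamond^{\le m}p_{h+1}\vee B_h(m))$; $L[h]=L+\{B_h(\mathrm{tr}(L))\}$. -}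

module Defs where

open import Data.Nat using (ℕ; zero; suc; _<_)
open import Data.Bool using (Bool; true; false; not; _∧_; _∨_)
open import Data.Empty using (⊥)
open import Relation.Binary.PropositionalEquality using (_≡_)
open import Relation.Nullary using (¬_)
open import Data.Product using (_×_; ∃-syntax)

data Fm : Set where
  var  : ℕ → Fm
  ⊥'   : Fm
  ⊤'   : Fm
  ¬'_  : Fm → Fm
  _∧'_ : Fm → Fm → Fm
  _∨'_ : Fm → Fm → Fm
  _⇒_  : Fm → Fm → Fm
  ◇_   : Fm → Fm

infixr 4 _⇒_
infixr 5 _∨'_
infixr 6 _∧'_
infix 7 ¬'_ ◇_

□_ : Fm → Fm
□ φ = ¬' ◇ ¬' φ
infix 7 □_

◇^ : ℕ → Fm → Fm
◇^ zero φ = φ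
◇^ (suc i) φ = ◇ (◇^ i φ)

□^ : ℕ → Fm → Fm
□^ zero φ = φ
□^ (suc i) φ = □ (□^ i φ)

◇≤ : ℕ → Fm → Fm
◇≤ zero φ = φ
◇≤ (suc m) φ = ◇≤ m φ ∨' ◇^ (suc m) φ

□≤ : ℕ → Fm → Fm
□≤ zero φ = φ
□≤ (suc m) φ = □≤ m φ ∧' □^ (suc m) φ

-- Propositional tautologies: true under every Boolean valuation in which
-- variables and formulas ◇ψ are treated as atoms.
eval : (Fm → Bool) → Fm → Bool
eval v (var n) = v (var n)
eval v ⊥' = false
eval v ⊤' = true
eval v (¬' φ) = not (eval v φ)
eval v (φ ∧' ψ) = eval v φ ∧ eval v ψ
eval v (φ ∨' ψ) = eval v φ ∨ eval v ψ
eval v (φ ⇒ ψ) = not (eval v φ) ∨ eval v ψ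
eval v (◇ φ) = v (◇ φ)

Tautology : Fm → Set
Tautology φ = (v : Fm → Bool) → eval v φ ≡ true

subst : (ℕ → Fm) → Fm → Fm
subst s (var n) = s n
subst s ⊥' = ⊥'
subst s ⊤' = ⊤'
subst s (¬' φ) = ¬' subst s φ
subst s (φ ∧' ψ) = subst s φ ∧' subst s ψ
subst s (φ ∨' ψ) = subst s φ ∨' subst s ψ
subst s (φ ⇒ ψ) = subst s φ ⇒ subst s ψ
subst s (◇ φ) = ◇ subst s φ

FmSet : Set₁
FmSet = Fm → Set

_⊆_ : FmSet → FmSet → Set
A ⊆ B = ∀ φ → A φ → B φ

record IsLogic (L : FmSet) : Set where
  field
    taut : ∀ φ → Tautology φ → L φ
    K⊥   : L (¬' ◇ ⊥')
    K∨   : L (◇ (var 1 ∨' var 2) ⇒ ◇ var 1 ∨' ◇ var 2)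
    mp   : ∀ φ ψ → L φ → L (φ ⇒ ψ) → L ψ
    sub  : ∀ s φ → L φ → L (subst s φ)
    mono : ∀ φ ψ → L (φ ⇒ ψ) → L (◇ φ ⇒ ◇ ψ)

data _+L_ (L Φ : FmSet) : FmSet where
  base  : ∀ {φ} → L φ → (L +L Φ) φ
  extra : ∀ {φ} → Φ φ → (L +L Φ) φ
  taut  : ∀ {φ} → Tautology φ → (L +L Φ) φ
  K⊥    : (L +L Φ) (¬' ◇ ⊥')
  K∨    : (L +L Φ) (◇ (var 1 ∨' var 2) ⇒ ◇ var 1 ∨' ◇ var 2)
  mp    : ∀ {φ ψ} → (L +L Φ) φ → (L +L Φ) (φ ⇒ ψ) → (L +L Φ) ψ
  sub   : ∀ {φ} s → (L +L Φ) φ → (L +L Φ) (subst s φ)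
  mono  : ∀ {φ ψ} → (L +L Φ) (φ ⇒ ψ) → (L +L Φ) (◇ φ ⇒ ◇ ψ)

Consistent : FmSet → Set
Consistent L = ¬ L ⊥'

PT : ℕ → Fm
PT m = ◇^ (suc m) (var 0) ⇒ ◇≤ m (var 0)

Pretransitive : FmSet → Set
Pretransitive L = ∃[ m ] L (PT m)

IsTr : FmSet → ℕ → Set
IsTr L m = L (PT m) × (∀ k → k < m → ¬ L (PT k))

-- Bs k m = B_{k+1}(m)   (p_i = var i)
Bs : ℕ → ℕ → Fm
Bs zero m = var 1 ⇒ □≤ m (◇≤ m (var 1))
Bs (suc k) m = var (suc (suc k)) ⇒ □≤ m (◇≤ m (var (suc (suc k))) ∨' Bs k m)

-- Ext L m k = L + {B_{k+1}(m)}; with m = tr(L) this is L[k+1]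
Ext : FmSet → ℕ → ℕ → FmSet
Ext L m k = L +L (λ ψ → ψ ≡ Bs k m)

module Submission where

-- Part (1) holds because any logic containing B_h proves B_{h+1}: weaken B_h to
-- ◇^{≤m} p ∨ B_h, necessitate, and prefix p →.
--
-- Part (2) is Makinson's theorem. Evaluate formulas at a single point that
-- either sees itself (◇φ ↔ φ) or sees nothing (◇φ ↔ ⊥). Both structures
-- validate every B_h, so it suffices that a consistent normal logic L is
-- valid at one of them. If L is refuted at the irreflexive point, substituting
-- the constants of the refuting valuation yields a variable-free theorem of L
-- which ¬◇⊤ refutes inside L, so L ⊢ ◇⊤. Over ◇⊤ every variable-free formula
-- is L-equivalent to its value at the reflexive point, so a refutation there
-- turns into L ⊢ ⊥.

open import Defs hiding (base; extra; taut; K⊥; K∨; mp; sub; mono)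
open import Data.Nat using (ℕ; zero; suc)
open import Data.Bool using (Bool; true; false; not; _∧_; _∨_; if_then_else_)
open import Data.Bool.Properties using (∧-zeroʳ)
open import Data.Empty using (⊥)
open import Data.Product using (_×_; _,_)
open import Relation.Nullary using (¬_)
open import Relation.Binary.PropositionalEquality as ≡ using (_≡_; refl; cong; cong₂)

lit : Bool → Fm → Fm
lit true A = A
lit false A = ¬' A

litᵇ : Bool → Bool → Bool
litᵇ true a = a
litᵇ false a = not a

eval-lit : ∀ w b A → eval w (lit b A) ≡ litᵇ b (eval w A)
eval-lit w true A = refl
eval-lit w false A = refl

litᵇ-refl : ∀ b → litᵇ b b ≡ true
litᵇ-refl true = refl
litᵇ-refl false = refl

litᵇ-sound : ∀ b a → litᵇ b a ≡ true → a ≡ b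
litᵇ-sound true true _ = refl
litᵇ-sound false false _ = refl

taut-lit-op : ∀ (op : Fm → Fm → Fm) (f : Bool → Bool → Bool) →
  (∀ w A B → eval w (op A B) ≡ f (eval w A) (eval w B)) →
  ∀ x y G A B → Tautology ((G ⇒ lit x A) ⇒ (G ⇒ lit y B) ⇒ (G ⇒ lit (f x y) (op A B)))
taut-lit-op op f eval-op x y G A B w
  rewrite eval-lit w x A | eval-lit w y B | eval-lit w (f x y) (op A B) | eval-op w A B
  with eval w G | litᵇ x (eval w A) in ea | litᵇ y (eval w B) in eb
... | false | _ | _ = refl
... | true | false | _ = refl
... | true | true | false = refl
... | true | true | true
  rewrite litᵇ-sound x (eval w A) ea | litᵇ-sound y (eval w B) eb = litᵇ-refl (f x y)

taut-lit-¬ : ∀ x G A → Tautology ((G ⇒ lit x A) ⇒ (G ⇒ lit (not x) (¬' A)))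
taut-lit-¬ x G A w rewrite eval-lit w x A | eval-lit w (not x) (¬' A)
  with eval w G | x | eval w A
... | false | _ | _ = refl
... | true | true | true = refl
... | true | true | false = refl
... | true | false | true = refl
... | true | false | false = refl

taut-⇒⊤ : ∀ G → Tautology (G ⇒ ⊤')
taut-⇒⊤ G w with eval w G
... | true = refl
... | false = refl

taut-⇒¬⊥ : ∀ G → Tautology (G ⇒ ¬' ⊥')
taut-⇒¬⊥ G w with eval w G
... | true = refl
... | false = refl

taut-K : ∀ A B → Tautology (A ⇒ B ⇒ A)
taut-K A B w with eval w A | eval w B
... | true | true = refl
... | true | false = refl
... | false | _ = refl

taut-∨-introʳ : ∀ A B → Tautology (B ⇒ A ∨' B)
taut-∨-introʳ A B w with eval w A | eval w B
... | true | true = refl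
... | false | true = refl
... | _ | false = refl

taut-∧-intro : ∀ A B → Tautology (A ⇒ B ⇒ A ∧' B)
taut-∧-intro A B w with eval w A | eval w B
... | true | true = refl
... | true | false = refl
... | false | _ = refl

taut-¬-elim : ∀ A → Tautology (A ⇒ ¬' A ⇒ ⊥')
taut-¬-elim A w with eval w A
... | true = refl
... | false = refl

taut-⊤⇒¬-elim : ∀ A → Tautology ((⊤' ⇒ ¬' A) ⇒ A ⇒ ⊥')
taut-⊤⇒¬-elim A w with eval w A
... | true = refl
... | false = refl

taut-contrapose : ∀ A B → Tautology ((A ⇒ B) ⇒ ¬' B ⇒ ¬' A)
taut-contrapose A B w with eval w A | eval w B
... | true | true = refl
... | true | false = refl
... | false | true = refl
... | false | false = refl

taut-modus-tollens : ∀ A B → Tautology (A ⇒ (¬' B ⇒ ¬' A) ⇒ B)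
taut-modus-tollens A B w with eval w A | eval w B
... | true | true = refl
... | true | false = refl
... | false | _ = refl

module Derivations {L : FmSet} (isL : IsLogic L) where
  open IsLogic isL

  by-taut₁ : ∀ {φ ψ} → L φ → Tautology (φ ⇒ ψ) → L ψ
  by-taut₁ ⊢φ t = mp _ _ ⊢φ (taut _ t)

  by-taut₂ : ∀ {φ₁ φ₂ ψ} → L φ₁ → L φ₂ → Tautology (φ₁ ⇒ φ₂ ⇒ ψ) → L ψ
  by-taut₂ ⊢φ₁ ⊢φ₂ t = mp _ _ ⊢φ₂ (by-taut₁ ⊢φ₁ t)

  ⇒-intro : ∀ {A B} → L A → L (B ⇒ A)
  ⇒-intro {A} {B} ⊢A = by-taut₁ ⊢A (taut-K A B)

  contrapose : ∀ {A B} → L (A ⇒ B) → L (¬' B) → L (¬' A)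
  contrapose {A} {B} ⊢A⇒B ⊢¬B = by-taut₂ ⊢A⇒B ⊢¬B (taut-contrapose A B)

  nec : ∀ {φ} → L φ → L (□ φ)
  nec {φ} ⊢φ = contrapose (mono _ _ (by-taut₁ ⊢φ (taut-¬-elim φ))) K⊥

  □^-nec : ∀ {φ} i → L φ → L (□^ i φ)
  □^-nec zero ⊢φ = ⊢φ
  □^-nec (suc i) ⊢φ = nec (□^-nec i ⊢φ)

  □≤-nec : ∀ {φ} m → L φ → L (□≤ m φ)
  □≤-nec zero ⊢φ = ⊢φ
  □≤-nec {φ} (suc m) ⊢φ =
    by-taut₂ (□≤-nec m ⊢φ) (□^-nec (suc m) ⊢φ) (taut-∧-intro (□≤ m φ) (□^ (suc m) φ))

  lit-¬ : ∀ {x G A} → L (G ⇒ lit x A) → L (G ⇒ lit (not x) (¬' A))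
  lit-¬ {x} {G} {A} ⊢x = by-taut₁ ⊢x (taut-lit-¬ x G A)

  lit-op : ∀ (op : Fm → Fm → Fm) (f : Bool → Bool → Bool) →
    (∀ w A B → eval w (op A B) ≡ f (eval w A) (eval w B)) →
    ∀ {x y G A B} → L (G ⇒ lit x A) → L (G ⇒ lit y B) → L (G ⇒ lit (f x y) (op A B))
  lit-op op f eval-op {x} {y} {G} {A} {B} ⊢x ⊢y =
    by-taut₂ ⊢x ⊢y (taut-lit-op op f eval-op x y G A B)

  Bs-suc : ∀ {k m} → L (Bs k m) → L (Bs (suc k) m)
  Bs-suc {k} {m} ⊢B = ⇒-intro (□≤-nec m (by-taut₁ ⊢B (taut-∨-introʳ (◇≤ m p) (Bs k m))))
    where p = var (suc (suc k))

module _ {L Φ : FmSet} where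
  open _+L_

  +L-isLogic : IsLogic (L +L Φ)
  +L-isLogic = record
    { taut = λ _ t → taut t ; K⊥ = K⊥ ; K∨ = K∨
    ; mp = λ _ _ → mp ; sub = λ s _ → sub s ; mono = λ _ _ → mono }

  ⊆-+L : L ⊆ (L +L Φ)
  ⊆-+L _ = base

  +L-least : ∀ {L′} → IsLogic L′ → L ⊆ L′ → Φ ⊆ L′ → (L +L Φ) ⊆ L′
  +L-least isL′ L⊆ Φ⊆ φ (base p) = L⊆ φ p
  +L-least isL′ L⊆ Φ⊆ φ (extra p) = Φ⊆ φ p
  +L-least isL′ L⊆ Φ⊆ φ (taut t) = IsLogic.taut isL′ φ t
  +L-least isL′ L⊆ Φ⊆ _ K⊥ = IsLogic.K⊥ isL′
  +L-least isL′ L⊆ Φ⊆ _ K∨ = IsLogic.K∨ isL′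
  +L-least isL′ L⊆ Φ⊆ ψ (mp {φ} d e) =
    IsLogic.mp isL′ φ ψ (+L-least isL′ L⊆ Φ⊆ _ d) (+L-least isL′ L⊆ Φ⊆ _ e)
  +L-least isL′ L⊆ Φ⊆ _ (sub {φ} s d) = IsLogic.sub isL′ s φ (+L-least isL′ L⊆ Φ⊆ _ d)
  +L-least isL′ L⊆ Φ⊆ _ (mono {φ} {ψ} d) = IsLogic.mono isL′ φ ψ (+L-least isL′ L⊆ Φ⊆ _ d)

Ext-antitone : ∀ L m k → Ext L m (suc k) ⊆ Ext L m k
Ext-antitone L m k =
  +L-least +L-isLogic ⊆-+L λ { _ refl → Derivations.Bs-suc +L-isLogic (_+L_.extra refl) }

-- Truth at a one-point frame whose point sees itself iff r is true.
evalPoint : Bool → (ℕ → Bool) → Fm → Bool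
evalPoint r v (var n) = v n
evalPoint r v ⊥' = false
evalPoint r v ⊤' = true
evalPoint r v (¬' φ) = not (evalPoint r v φ)
evalPoint r v (φ ∧' ψ) = evalPoint r v φ ∧ evalPoint r v ψ
evalPoint r v (φ ∨' ψ) = evalPoint r v φ ∨ evalPoint r v ψ
evalPoint r v (φ ⇒ ψ) = not (evalPoint r v φ) ∨ evalPoint r v ψ
evalPoint r v (◇ φ) = r ∧ evalPoint r v φ

ValidAtPoint : Bool → FmSet
ValidAtPoint r φ = ∀ v → evalPoint r v φ ≡ true

eval-evalPoint : ∀ r v φ → eval (evalPoint r v) φ ≡ evalPoint r v φ
eval-evalPoint r v (var n) = refl
eval-evalPoint r v ⊥' = refl
eval-evalPoint r v ⊤' = refl
eval-evalPoint r v (¬' φ) = cong not (eval-evalPoint r v φ)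
eval-evalPoint r v (φ ∧' ψ) = cong₂ _∧_ (eval-evalPoint r v φ) (eval-evalPoint r v ψ)
eval-evalPoint r v (φ ∨' ψ) = cong₂ _∨_ (eval-evalPoint r v φ) (eval-evalPoint r v ψ)
eval-evalPoint r v (φ ⇒ ψ) =
  cong₂ (λ a b → not a ∨ b) (eval-evalPoint r v φ) (eval-evalPoint r v ψ)
eval-evalPoint r v (◇ φ) = refl

evalPoint-subst : ∀ r v s φ →
  evalPoint r v (subst s φ) ≡ evalPoint r (λ n → evalPoint r v (s n)) φ
evalPoint-subst r v s (var n) = refl
evalPoint-subst r v s ⊥' = refl
evalPoint-subst r v s ⊤' = refl
evalPoint-subst r v s (¬' φ) = cong not (evalPoint-subst r v s φ)
evalPoint-subst r v s (φ ∧' ψ) = cong₂ _∧_ (evalPoint-subst r v s φ) (evalPoint-subst r v s ψ)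
evalPoint-subst r v s (φ ∨' ψ) = cong₂ _∨_ (evalPoint-subst r v s φ) (evalPoint-subst r v s ψ)
evalPoint-subst r v s (φ ⇒ ψ) =
  cong₂ (λ a b → not a ∨ b) (evalPoint-subst r v s φ) (evalPoint-subst r v s ψ)
evalPoint-subst r v s (◇ φ) = cong (r ∧_) (evalPoint-subst r v s φ)

ValidAtPoint-isLogic : ∀ r → IsLogic (ValidAtPoint r)
ValidAtPoint-isLogic r = record
  { taut = λ φ t v → ≡.trans (≡.sym (eval-evalPoint r v φ)) (t _)
  ; K⊥ = K⊥ r
  ; K∨ = K∨ r
  ; mp = λ φ ψ ⊨φ ⊨φ⇒ψ v → modus-ponens (⊨φ v) (⊨φ⇒ψ v)
  ; sub = λ s φ ⊨φ v → ≡.trans (evalPoint-subst r v s φ) (⊨φ _)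
  ; mono = mono r
  }
  where
  modus-ponens : ∀ {a b} → a ≡ true → not a ∨ b ≡ true → b ≡ true
  modus-ponens refl b = b

  K⊥ : ∀ r → ValidAtPoint r (¬' ◇ ⊥')
  K⊥ true v = refl
  K⊥ false v = refl

  K∨ : ∀ r → ValidAtPoint r (◇ (var 1 ∨' var 2) ⇒ ◇ var 1 ∨' ◇ var 2)
  K∨ false v = refl
  K∨ true v with v 1 | v 2
  ... | true | _ = refl
  ... | false | true = refl
  ... | false | false = refl

  mono : ∀ r φ ψ → ValidAtPoint r (φ ⇒ ψ) → ValidAtPoint r (◇ φ ⇒ ◇ ψ)
  mono true φ ψ ⊨φ⇒ψ = ⊨φ⇒ψ
  mono false φ ψ ⊨φ⇒ψ v = refl

ValidAtPoint-consistent : ∀ r → Consistent (ValidAtPoint r)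
ValidAtPoint-consistent r ⊨⊥ with ⊨⊥ (λ _ → true)
... | ()

◇≤-true : ∀ r v {φ} m → evalPoint r v φ ≡ true → evalPoint r v (◇≤ m φ) ≡ true
◇≤-true r v zero e = e
◇≤-true r v {φ} (suc m) e rewrite ◇≤-true r v {φ} m e = refl

□^-true : ∀ r v {φ} i → evalPoint r v φ ≡ true → evalPoint r v (□^ i φ) ≡ true
□^-true r v zero e = e
□^-true r v {φ} (suc i) e rewrite □^-true r v {φ} i e | ∧-zeroʳ r = refl

□≤-true : ∀ r v {φ} m → evalPoint r v φ ≡ true → evalPoint r v (□≤ m φ) ≡ true
□≤-true r v zero e = e
□≤-true r v {φ} (suc m) e rewrite □≤-true r v {φ} m e | □^-true r v {φ} (suc m) e = refl

Bs-ValidAtPoint : ∀ r k m → ValidAtPoint r (Bs k m)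
Bs-ValidAtPoint r 0 m v with v 1 in eq
... | false = refl
... | true = □≤-true r v m (◇≤-true r v m eq)
Bs-ValidAtPoint r (suc k) m v with v (suc (suc k)) in eq
... | false = refl
... | true = □≤-true r v m (cong (_∨ evalPoint r v (Bs k m)) (◇≤-true r v m eq))

constants : (ℕ → Bool) → ℕ → Fm
constants v n = if v n then ⊤' else ⊥'

-- Under the hypothesis G, ◇ must act on literals as it does at the point r; then
-- every constant instance of φ is decided under G by its value at that point.
module Reduction {L : FmSet} (isL : IsLogic L) (r : Bool) (G : Fm)
  (◇-lit : ∀ b χ → L (G ⇒ lit b χ) → L (G ⇒ lit (r ∧ b) (◇ χ))) where
  open IsLogic isL using (taut)
  open Derivations isL

  decide : ∀ v φ → L (G ⇒ lit (evalPoint r v φ) (subst (constants v) φ))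
  decide v (var n) with v n
  ... | true = taut _ (taut-⇒⊤ G)
  ... | false = taut _ (taut-⇒¬⊥ G)
  decide v ⊥' = taut _ (taut-⇒¬⊥ G)
  decide v ⊤' = taut _ (taut-⇒⊤ G)
  decide v (¬' φ) = lit-¬ (decide v φ)
  decide v (φ ∧' ψ) = lit-op _∧'_ _∧_ (λ _ _ _ → refl) (decide v φ) (decide v ψ)
  decide v (φ ∨' ψ) = lit-op _∨'_ _∨_ (λ _ _ _ → refl) (decide v φ) (decide v ψ)
  decide v (φ ⇒ ψ) = lit-op _⇒_ (λ a b → not a ∨ b) (λ _ _ _ → refl) (decide v φ) (decide v ψ)
  decide v (◇ φ) = ◇-lit _ _ (decide v φ)

  refute : ∀ v φ → evalPoint r v φ ≡ false → L (G ⇒ ¬' subst (constants v) φ)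
  refute v φ refuted =
    ≡.subst (λ b → L (G ⇒ lit b (subst (constants v) φ))) refuted (decide v φ)

module _ {L : FmSet} (isL : IsLogic L) where
  open IsLogic isL
  open Derivations isL

  refuted-irreflexive⇒◇⊤ : ∀ {φ} v → L φ → evalPoint false v φ ≡ false → L (◇ ⊤')
  refuted-irreflexive⇒◇⊤ {φ} v ⊢φ refuted =
    by-taut₂ (sub (constants v) φ ⊢φ) (refute v φ refuted)
      (taut-modus-tollens (subst (constants v) φ) (◇ ⊤'))
    where
    G = ¬' ◇ ⊤'
    ◇-lit : ∀ b χ → L (G ⇒ lit b χ) → L (G ⇒ lit (false ∧ b) (◇ χ))
    ◇-lit _ χ _ = by-taut₁ (mono _ _ (taut _ (taut-⇒⊤ χ))) (taut-contrapose (◇ χ) (◇ ⊤'))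
    open Reduction isL false G ◇-lit

  refuted-reflexive⇒⊥ : L (◇ ⊤') → ∀ {ψ} w → L ψ → evalPoint true w ψ ≡ false → L ⊥'
  refuted-reflexive⇒⊥ ⊢◇⊤ {ψ} w ⊢ψ refuted =
    mp _ _ (sub (constants w) ψ ⊢ψ)
      (by-taut₁ (refute w ψ refuted) (taut-⊤⇒¬-elim (subst (constants w) ψ)))
    where
    ◇-lit : ∀ b χ → L (⊤' ⇒ lit b χ) → L (⊤' ⇒ lit (true ∧ b) (◇ χ))
    ◇-lit true χ ⊢χ = ⇒-intro (mp _ _ ⊢◇⊤ (mono _ _ ⊢χ))
    ◇-lit false χ ⊢¬χ = ⇒-intro (contrapose (mono _ _ (by-taut₁ ⊢¬χ (taut-⊤⇒¬-elim χ))) K⊥)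
    open Reduction isL true ⊤' ◇-lit

⊆-ValidAtPoint : ∀ {L} r →
  (∀ {φ} v → L φ → evalPoint r v φ ≡ false → ⊥) → L ⊆ ValidAtPoint r
⊆-ValidAtPoint r no-refutation φ ⊢φ v with evalPoint r v φ in eq
... | true = refl
... | false with () ← no-refutation v ⊢φ eq

+L-consistent : ∀ {L Φ} → IsLogic L → Consistent L →
  Φ ⊆ ValidAtPoint false → Φ ⊆ ValidAtPoint true → Consistent (L +L Φ)
+L-consistent {L} {Φ} isL consistent Φ-irreflexive Φ-reflexive ⊢⊥ =
  unrefuted false Φ-irreflexive λ v ⊢φ refuted →
  unrefuted true Φ-reflexive λ w ⊢ψ refuted′ →
  consistent (refuted-reflexive⇒⊥ isL (refuted-irreflexive⇒◇⊤ isL v ⊢φ refuted) w ⊢ψ refuted′)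
  where
  unrefuted : ∀ r → Φ ⊆ ValidAtPoint r → ¬ (∀ {φ} v → L φ → evalPoint r v φ ≡ false → ⊥)
  unrefuted r Φ-valid no-refutation = ValidAtPoint-consistent r
    (+L-least (ValidAtPoint-isLogic r) (⊆-ValidAtPoint r no-refutation) Φ-valid ⊥' ⊢⊥)

Ext-consistent : ∀ {L} → IsLogic L → Consistent L → ∀ m k → Consistent (Ext L m k)
Ext-consistent isL consistent m k = +L-consistent isL consistent (Bs-valid false) (Bs-valid true)
  where
  Bs-valid : ∀ r → (λ ψ → ψ ≡ Bs k m) ⊆ ValidAtPoint r
  Bs-valid r _ refl = Bs-ValidAtPoint r k m

-- Neither part needs m = tr(L): the argument works for every m.
proposition16 : (L : FmSet) → IsLogic L → (m : ℕ) → IsTr L m →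
    ((∀ k → Ext L m (suc k) ⊆ Ext L m k) × (∀ k → L ⊆ Ext L m k))
    × (Consistent L → Consistent (Ext L m 0) × (∀ k → Consistent (Ext L m k)))
proposition16 L isL m _ =
  (Ext-antitone L m , λ _ → ⊆-+L) ,
  λ consistent → Ext-consistent isL consistent m 0 , Ext-consistent isL consistent m
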